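{- Let $\Delta$ be a positive integer. If there exists a constant $0<c_{\Delta}<1$ such that $\mathrm{es}_{\Delta}(H)\le c_{\Delta}|V(H)|$ holds for every $\Delta$-regular graph $H$, then $\mathrm{es}_{\Delta}(G)\le c_{\Delta}|V(G)|$ holds for every graph $G$ with maximum degree $\Delta(G)=\Delta$.
   Context: All graphs are finite, simple, with at least one edge. The $\Delta$-edge stability number $\mathrm{es}_{\Delta}(G)$ of a graph $G$ is the minimum number of edges of $G$ whose removal results in a subgraph $H$ with $\Delta(H)=\Delta(G)-1$, where $\Delta(\cdot)$ denotes maximum degree.
   Formalization: The constant $c_{\Delta}$ ranges over the rationals strictly between 0 and 1. -}

module Defs where

open import Data.Nat using (ℕ; zero; suc; _+_; _∸_; _⊔_; _<_)
open import Data.Bool using (Bool; true; false; if_then_else_)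
open import Data.Fin using (Fin; toℕ)
open import Data.List using (List; []; _∷_; map; foldr; allFin)
open import Data.Nat.ListAction using (sum)
open import Data.Product using (Σ; ∃; _×_; _,_)
open import Relation.Binary.PropositionalEquality using (_≡_)
open import Relation.Nullary using (¬_)
open import Data.Integer using (+_)
open import Data.Rational using (ℚ; _/_)

record Graph : Set where
  field
    n     : ℕ
    adj   : Fin n → Fin n → Bool
    sym   : ∀ i j → adj i j ≡ adj j i
    irrefl : ∀ i → adj i i ≡ false
open Graph public

b2n : Bool → ℕ
b2n true  = 1
b2n false = 0

deg : (G : Graph) → Fin (n G) → ℕ
deg G i = sum (map (λ j → b2n (adj G i j)) (allFin (n G)))

maxDeg : Graph → ℕ
maxDeg G = foldr _⊔_ 0 (map (deg G) (allFin (n G)))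

numEdges : Graph → ℕ
numEdges G = sum (map (λ i → sum (map (λ j → if (toℕ i Data.Nat.<ᵇ toℕ j) then b2n (adj G i j) else 0)
                                      (allFin (n G))))
                      (allFin (n G)))

record EdgeDeletion (G : Graph) : Set where
  field
    H      : Graph
    sameV  : n H ≡ n G
    subset : ∀ (i j : Fin (n H)) → adj H i j ≡ true →
             adj G (Data.Fin.cast sameV i) (Data.Fin.cast sameV j) ≡ true
open EdgeDeletion public

deleted : {G : Graph} → EdgeDeletion G → ℕ
deleted {G} D = numEdges G ∸ numEdges (H D)

Lowers : (G : Graph) → EdgeDeletion G → Set
Lowers G D = maxDeg (H D) ≡ maxDeg G ∸ 1

-- ES G k  :  es_Δ(G) = k, i.e. k is the minimum number of deleted edges
-- over all edge deletions H with Δ(H) = Δ(G) - 1.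
ES : Graph → ℕ → Set
ES G k = (Σ (EdgeDeletion G) λ D → Lowers G D × deleted D ≡ k)
       × (∀ (D : EdgeDeletion G) → Lowers G D → k Data.Nat.≤ deleted D)

HasEdge : Graph → Set
HasEdge G = ∃ λ i → ∃ λ j → adj G i j ≡ true

Regular : ℕ → Graph → Set
Regular d G = ∀ i → deg G i ≡ d

ℕtoℚ : ℕ → ℚ
ℕtoℚ k = (+ k) / 1

{-# OPTIONS --safe #-}
module Submission where

-- Take two copies of a graph K of maximum degree at most Δ and join every vertex of degree below Δ
-- to its twin.  The number of vertices doubles, every degree below Δ rises by one, and the cost
-- es_Δ at least doubles, because a subgraph of the double with maximum degree at most Δ − 1
-- restricts to such a subgraph on each copy.  After Δ doublings G has become a Δ-regular graph H
-- with 2^Δ |V(G)| vertices and es_Δ(H) ≥ 2^Δ es_Δ(G), so c |V(H)| ≥ es_Δ(H) yields the bound for G.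
-- Comparing costs uses that the fewest deletions reaching maximum degree exactly Δ − 1 are also
-- the fewest reaching maximum degree at most Δ − 1.

open import Algebra.Properties.CommutativeMonoid.Sum as Sum using ()
open import Data.Bool using (Bool; true; false; _∧_; _∨_; if_then_else_)
import Data.Bool.Properties as Bool
open import Data.Fin using (Fin; zero; suc; toℕ; _↑ˡ_; _↑ʳ_; splitAt; combine; remQuot)
open import Data.Fin.Properties using (_≟_; cast-is-id; remQuot-combine)
import Data.Fin.Properties as Fin
open import Data.Fin.Subset using (Subset)
open import Data.Fin.Subset.Properties using (anySubset?)
import Data.Integer as ℤ
import Data.Integer.Properties as ℤ
open import Data.List as List using (allFin)
open import Data.List.Properties using (map-tabulate)
open import Data.Nat as ℕ
  using (ℕ; zero; suc; _+_; _*_; _^_; _∸_; _⊔_; _⊓_; _≤_; _<_; _<ᵇ_; z≤n; s≤s; s≤s⁻¹; _<?_; _≤?_)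
open import Data.Nat.Coprimality using (1-coprimeTo) renaming (sym to coprime-sym)
open import Data.Nat.Properties hiding (_≟_)
open import Data.Nat.Solver using (module +-*-Solver)
open import Data.Product using (∃; ∃₂; _×_; _,_; proj₁; proj₂; map; uncurry)
open import Data.Rational as ℚ using (ℚ; mkℚ; 0ℚ; 1ℚ) renaming (_<_ to _<ℚ_)
import Data.Rational.Properties as ℚ
open import Data.Sum using (_⊎_; inj₁; inj₂; [_,_]′)
open import Data.Vec using (lookup; tabulate)
open import Data.Vec.Functional as Vector using ()
open import Data.Vec.Properties using (lookup∘tabulate)
open import Function using (_∘_; id; Equivalence)
open import Relation.Binary using (tri<; tri≈; tri>)
open import Relation.Binary.PropositionalEquality
open import Relation.Nullary using (¬_; Dec; yes; no; does; contradiction)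
open import Relation.Nullary.Reflects using (ofʸ; ofⁿ)
open import Relation.Nullary.Decidable using (_×-dec_; _→-dec_; dec-true)
open import Relation.Unary using (Pred; Decidable)

open import Defs hiding (sym)

open Sum +-0-commutativeMonoid using (sum; sum-syntax; sum-cong-≗; ∑-distrib-+; sum-replicate-zero)

∑-mono-≤ : ∀ {n} {f g : Fin n → ℕ} → (∀ i → f i ≤ g i) → sum f ≤ sum g
∑-mono-≤ {zero}  f≤g = z≤n
∑-mono-≤ {suc n} f≤g = +-mono-≤ (f≤g zero) (∑-mono-≤ (f≤g ∘ suc))

∑-mono-< : ∀ {n} {f g : Fin n → ℕ} → (∀ i → f i ≤ g i) → ∀ j → f j < g j → sum f < sum g
∑-mono-< f≤g zero    fj<gj = +-mono-<-≤ fj<gj (∑-mono-≤ (f≤g ∘ suc))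
∑-mono-< f≤g (suc j) fj<gj = +-mono-≤-< (f≤g zero) (∑-mono-< (f≤g ∘ suc) j fj<gj)

∑-<⇒∃< : ∀ {n} {f g : Fin n → ℕ} → sum f < sum g → ∃ λ i → f i < g i
∑-<⇒∃< {suc n} {f} {g} lt with f zero <? g zero | sum (f ∘ suc) <? sum (g ∘ suc)
... | yes f₀<g₀ | _    = zero , f₀<g₀
... | no _      | yes rest< = map suc id (∑-<⇒∃< rest<)
... | no f₀≮g₀  | no rest≮ = contradiction lt (≤⇒≯ (+-mono-≤ (≮⇒≥ f₀≮g₀) (≮⇒≥ rest≮)))

∑-++ : ∀ m {n} (f : Fin (m + n) → ℕ) → sum f ≡ sum (f ∘ (_↑ˡ n)) + sum (f ∘ (m ↑ʳ_))
∑-++ zero    f = refl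
∑-++ (suc m) f = trans (cong (f zero +_) (∑-++ m (f ∘ suc))) (sym (+-assoc (f zero) _ _))

∑-δ : ∀ {n} (i : Fin n) (b : Bool) → sum (λ j → b2n (does (i ≟ j) ∧ b)) ≡ b2n b
∑-δ {suc n} zero b = trans (cong (b2n b +_) (sum-replicate-zero n)) (+-identityʳ _)
∑-δ (suc i) b = ∑-δ i b

⨆ : ∀ {n} → (Fin n → ℕ) → ℕ
⨆ = Vector.foldr _⊔_ 0

≤-⨆ : ∀ {n} (f : Fin n → ℕ) i → f i ≤ ⨆ f
≤-⨆ f zero    = m≤m⊔n _ _
≤-⨆ f (suc i) = ≤-trans (≤-⨆ (f ∘ suc) i) (m≤n⊔m _ _)

⨆-lub : ∀ {n} {f : Fin n → ℕ} {b} → (∀ i → f i ≤ b) → ⨆ f ≤ b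
⨆-lub {zero}  f≤b = z≤n
⨆-lub {suc n} f≤b = ⊔-lub (f≤b zero) (⨆-lub (f≤b ∘ suc))

⨆-cong : ∀ {n} {f g : Fin n → ℕ} → (∀ i → f i ≡ g i) → ⨆ f ≡ ⨆ g
⨆-cong {zero}  f≗g = refl
⨆-cong {suc n} f≗g = cong₂ _⊔_ (f≗g zero) (⨆-cong (f≗g ∘ suc))

<-⨆⇒∃< : ∀ {n} {f : Fin n → ℕ} {b} → b < ⨆ f → ∃ λ i → b < f i
<-⨆⇒∃< {suc n} {f} b<⨆ with ⊔-sel (f zero) (⨆ (f ∘ suc))
... | inj₁ ⨆≡f₀ = zero , subst (_ <_) ⨆≡f₀ b<⨆
... | inj₂ ⨆≡rest = map suc id (<-⨆⇒∃< (subst (_ <_) ⨆≡rest b<⨆))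

foldr-tabulate : ∀ {n} (_∙_ : ℕ → ℕ → ℕ) e (f : Fin n → ℕ) →
                 List.foldr _∙_ e (List.tabulate f) ≡ Vector.foldr _∙_ e f
foldr-tabulate {zero}  _∙_ e f = refl
foldr-tabulate {suc n} _∙_ e f = cong (f zero ∙_) (foldr-tabulate _∙_ e (f ∘ suc))

foldr-map-allFin : ∀ {n} (_∙_ : ℕ → ℕ → ℕ) e (f : Fin n → ℕ) →
                   List.foldr _∙_ e (List.map f (allFin n)) ≡ Vector.foldr _∙_ e f
foldr-map-allFin _∙_ e f = trans (cong (List.foldr _∙_ e) (map-tabulate id f)) (foldr-tabulate _∙_ e f)

Adj : ℕ → Set
Adj n = Fin n → Fin n → Bool

_⊆ₐ_ : ∀ {n} → Adj n → Adj n → Set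
a ⊆ₐ b = ∀ i j → a i j ≡ true → b i j ≡ true

_≐_ : ∀ {n} → Adj n → Adj n → Set
a ≐ b = ∀ i j → a i j ≡ b i j

_∪_ : ∀ {n} → Adj n → Adj n → Adj n
(a ∪ b) i j = a i j ∨ b i j

degree : ∀ {n} → Adj n → Fin n → ℕ
degree {n} a i = ∑[ j < n ] b2n (a i j)

maxDegree : ∀ {n} → Adj n → ℕ
maxDegree a = ⨆ (degree a)

edgeCount : ∀ {n} → Adj n → ℕ
edgeCount {n} a = ∑[ i < n ] ∑[ j < n ] (if toℕ i <ᵇ toℕ j then b2n (a i j) else 0)

b2n-mono : ∀ {x y} → (x ≡ true → y ≡ true) → b2n x ≤ b2n y
b2n-mono {false} _   = z≤n
b2n-mono {true}  x⇒y rewrite x⇒y refl = ≤-refl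

b2n-∨ : ∀ x y → b2n (x ∨ y) ≤ b2n x + b2n y
b2n-∨ false y     = ≤-refl
b2n-∨ true  false = ≤-refl
b2n-∨ true  true  = s≤s z≤n

if-mono : ∀ c {x y} → x ≤ y → (if c then x else 0) ≤ (if c then y else 0)
if-mono true  x≤y = x≤y
if-mono false _   = z≤n

edgeCount-mono : ∀ {n} {a b : Adj n} → a ⊆ₐ b → edgeCount a ≤ edgeCount b
edgeCount-mono a⊆b = ∑-mono-≤ λ i → ∑-mono-≤ λ j → if-mono (toℕ i <ᵇ toℕ j) (b2n-mono (a⊆b i j))

degree-cong : ∀ {n} {a b : Adj n} → a ≐ b → ∀ i → degree a i ≡ degree b i
degree-cong a≐b i = sum-cong-≗ λ j → cong b2n (a≐b i j)

maxDegree-cong : ∀ {n} {a b : Adj n} → a ≐ b → maxDegree a ≡ maxDegree b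
maxDegree-cong a≐b = ⨆-cong (degree-cong a≐b)

edgeCount-cong : ∀ {n} {a b : Adj n} → a ≐ b → edgeCount a ≡ edgeCount b
edgeCount-cong a≐b = sum-cong-≗ λ i → sum-cong-≗ λ j →
  cong (λ x → if toℕ i <ᵇ toℕ j then b2n x else 0) (a≐b i j)

degree-∪ : ∀ {n} (a b : Adj n) i → degree (a ∪ b) i ≤ degree a i + degree b i
degree-∪ a b i = ≤-trans (∑-mono-≤ λ j → b2n-∨ (a i j) (b i j))
                         (≤-reflexive (∑-distrib-+ (λ j → b2n (a i j)) (λ j → b2n (b i j))))

deg≡degree : ∀ G i → deg G i ≡ degree (adj G) i
deg≡degree G i = foldr-map-allFin _+_ 0 (λ j → b2n (adj G i j))

maxDeg≡maxDegree : ∀ G → maxDeg G ≡ maxDegree (adj G)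
maxDeg≡maxDegree G = trans (foldr-map-allFin _⊔_ 0 (deg G)) (⨆-cong (deg≡degree G))

numEdges≡edgeCount : ∀ G → numEdges G ≡ edgeCount (adj G)
numEdges≡edgeCount G = trans (foldr-map-allFin _+_ 0 row) (sum-cong-≗ λ i → foldr-map-allFin _+_ 0 (entry i))
  where
  entry : Fin (n G) → Fin (n G) → ℕ
  entry i j = if toℕ i <ᵇ toℕ j then b2n (adj G i j) else 0
  row : Fin (n G) → ℕ
  row i = List.foldr _+_ 0 (List.map (entry i) (allFin (n G)))

record Spanning (G : Graph) : Set where
  field
    edge        : Adj (n G)
    edge-sym    : ∀ i j → edge i j ≡ edge j i
    edge-irrefl : ∀ i → edge i i ≡ false
    edge-⊆      : edge ⊆ₐ adj G
open Spanning public

asGraph : ∀ {G} → Spanning G → Graph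
asGraph {G} s = record { n = n G ; adj = edge s ; sym = edge-sym s ; irrefl = edge-irrefl s }

asDeletion : ∀ {G} → Spanning G → EdgeDeletion G
asDeletion {G} s = record
  { H = asGraph s
  ; sameV = refl
  ; subset = λ i j sij →
      subst₂ (λ x y → adj G x y ≡ true) (sym (cast-is-id refl i)) (sym (cast-is-id refl j)) (edge-⊆ s i j sij)
  }

fromDeletion : ∀ {G} → EdgeDeletion G → Spanning G
fromDeletion {G} record { H = H ; sameV = refl ; subset = H⊆G } = record
  { edge = adj H
  ; edge-sym = Graph.sym H
  ; edge-irrefl = irrefl H
  ; edge-⊆ = λ i j hij →
      subst₂ (λ x y → adj G x y ≡ true) (cast-is-id refl i) (cast-is-id refl j) (H⊆G i j hij)
  }

asDeletion-lowers : ∀ {G} (s : Spanning G) → maxDegree (edge s) ≡ maxDeg G ∸ 1 → Lowers G (asDeletion s)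
asDeletion-lowers s = trans (maxDeg≡maxDegree (asGraph s))

fromDeletion-lowers : ∀ {G} (D : EdgeDeletion G) → Lowers G D → maxDegree (edge (fromDeletion D)) ≡ maxDeg G ∸ 1
fromDeletion-lowers record { H = H ; sameV = refl } = trans (sym (maxDeg≡maxDegree H))

deleted-fromDeletion : ∀ {G} (D : EdgeDeletion G) →
                       deleted D ≡ edgeCount (adj G) ∸ edgeCount (edge (fromDeletion D))
deleted-fromDeletion {G} record { H = H ; sameV = refl } =
  cong₂ _∸_ (numEdges≡edgeCount G) (numEdges≡edgeCount H)

-- Largest subgraphs of bounded maximum degree

greatest : ∀ {ℓ} {Q : Pred ℕ ℓ} → Decidable Q → ∀ bound → (∀ {j} → Q j → j ≤ bound) →
           ∀ {j₀} → Q j₀ → ∃ λ k → Q k × (∀ {j} → Q j → j ≤ k)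
greatest Q? zero      ≤bound q₀ = _ , q₀ , λ qj → ≤-trans (≤bound qj) z≤n
greatest Q? (suc top) ≤bound q₀ with Q? (suc top)
... | yes q = suc top , q , ≤bound
... | no ¬q = greatest Q? top (λ qj → s≤s⁻¹ (≤∧≢⇒< (≤bound qj) λ { refl → ¬q qj })) q₀

argmax-Subset : ∀ {m ℓ} {P : Pred (Subset m) ℓ} → Decidable P → (f : Subset m → ℕ) →
                ∀ bound → (∀ {S} → P S → f S ≤ bound) → ∃ P →
                ∃ λ S → P S × (∀ {S′} → P S′ → f S′ ≤ f S)
argmax-Subset P? f bound ≤bound (S₀ , pS₀)
  with greatest (λ j → anySubset? λ S → P? S ×-dec f S ℕ.≟ j) bound (λ { (S , pS , refl) → ≤bound pS })
                (S₀ , pS₀ , refl)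
... | _ , (S , pS , refl) , ≤max = S , pS , λ pS′ → ≤max (_ , pS′ , refl)

record LargestWithin (G : Graph) (d : ℕ) : Set where
  field
    spanning : Spanning G
    within   : maxDegree (edge spanning) ≤ d
    largest  : ∀ (s : Spanning G) → maxDegree (edge s) ≤ d → edgeCount (edge s) ≤ edgeCount (edge spanning)

module _ (G : Graph) (d : ℕ) where

  private
    N = n G

    SpanningWithin : Adj N → Set
    SpanningWithin a = (∀ i j → a i j ≡ a j i) × (∀ i → a i i ≡ false) × a ⊆ₐ adj G × maxDegree a ≤ d

    spanningWithin? : ∀ a → Dec (SpanningWithin a)
    spanningWithin? a = Fin.all? (λ i → Fin.all? λ j → a i j Bool.≟ a j i)
                 ×-dec Fin.all? (λ i → a i i Bool.≟ false)
                 ×-dec Fin.all? (λ i → Fin.all? λ j → (a i j Bool.≟ true) →-dec (adj G i j Bool.≟ true))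
                 ×-dec maxDegree a ≤? d

    -- Adjacency matrices are encoded as subsets of Fin (N * N), which anySubset? can search.
    fromSubset : Subset (N * N) → Adj N
    fromSubset S i j = lookup S (combine i j)

    toSubset : Adj N → Subset (N * N)
    toSubset a = tabulate (uncurry a ∘ remQuot N)

    fromSubset-toSubset : ∀ a → fromSubset (toSubset a) ≐ a
    fromSubset-toSubset a i j = trans (lookup∘tabulate _ (combine i j)) (cong (uncurry a) (remQuot-combine i j))

    SpanningWithin-≐ : ∀ {a b} → a ≐ b → SpanningWithin a → SpanningWithin b
    SpanningWithin-≐ a≐b (a-sym , a-irrefl , a⊆G , a≤d) =
      (λ i j → trans (sym (a≐b i j)) (trans (a-sym i j) (a≐b j i))) ,
      (λ i → trans (sym (a≐b i i)) (a-irrefl i)) ,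
      (λ i j bij → a⊆G i j (trans (a≐b i j) bij)) ,
      subst (_≤ d) (maxDegree-cong a≐b) a≤d

    empty : Adj N
    empty _ _ = false

    empty-within : SpanningWithin empty
    empty-within = (λ _ _ → refl) , (λ _ → refl) , (λ _ _ ()) ,
                   ⨆-lub {f = degree empty} λ _ → ≤-trans (≤-reflexive (sum-replicate-zero N)) z≤n

  largestWithin : LargestWithin G d
  largestWithin
    with argmax-Subset (spanningWithin? ∘ fromSubset) (edgeCount ∘ fromSubset) (edgeCount (adj G))
                       (λ (_ , _ , a⊆G , _) → edgeCount-mono a⊆G)
                       (toSubset empty , SpanningWithin-≐ (λ i j → sym (fromSubset-toSubset empty i j)) empty-within)
  ... | S , (S-sym , S-irrefl , S⊆G , S≤d) , ≤max = record { spanning = s ; within = S≤d ; largest = most }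
    where
    s : Spanning G
    s = record { edge = fromSubset S ; edge-sym = S-sym ; edge-irrefl = S-irrefl ; edge-⊆ = S⊆G }
    most : ∀ (s′ : Spanning G) → maxDegree (edge s′) ≤ d → edgeCount (edge s′) ≤ edgeCount (edge s)
    most s′ s′≤d = subst (_≤ _) (edgeCount-cong (fromSubset-toSubset (edge s′)))
      (≤max {toSubset (edge s′)} (SpanningWithin-≐ (λ i j → sym (fromSubset-toSubset (edge s′) i j))
                                                    (edge-sym s′ , edge-irrefl s′ , edge-⊆ s′ , s′≤d)))

link : ∀ {n} → Fin n → Fin n → Adj n
link x y p q = (does (y ≟ q) ∧ does (x ≟ p)) ∨ (does (x ≟ q) ∧ does (y ≟ p))

module _ {n} {x y : Fin n} where

  link-sym : ∀ p q → link x y p q ≡ link x y q p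
  link-sym p q = trans (Bool.∨-comm (does (y ≟ q) ∧ does (x ≟ p)) _)
                       (cong₂ _∨_ (Bool.∧-comm (does (x ≟ q)) _) (Bool.∧-comm (does (y ≟ q)) _))

  link-endpoints : ∀ {p q} → link x y p q ≡ true → (x ≡ p × y ≡ q) ⊎ (y ≡ p × x ≡ q)
  link-endpoints {p} {q} xy≡pq with y ≟ q | x ≟ p | x ≟ q | y ≟ p
  ... | yes y≡q | yes x≡p | _       | _       = inj₁ (x≡p , y≡q)
  ... | _       | _       | yes x≡q | yes y≡p = inj₂ (y≡p , x≡q)
  ... | no _    | _       | no _    | _       = contradiction xy≡pq λ ()
  ... | no _    | _       | yes _   | no _    = contradiction xy≡pq λ ()
  ... | yes _   | no _    | no _    | _       = contradiction xy≡pq λ ()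
  ... | yes _   | no _    | yes _   | no _    = contradiction xy≡pq λ ()

  module _ (x≢y : x ≢ y) where

    link-irrefl : ∀ p → link x y p p ≡ false
    link-irrefl p with link x y p p in pp
    ... | false = refl
    ... | true with link-endpoints pp
    ...   | inj₁ (refl , refl) = contradiction refl x≢y
    ...   | inj₂ (refl , refl) = contradiction refl x≢y

    degree-link : ∀ p → degree (link x y) p ≤ 1
    degree-link p = begin
      degree (link x y) p
        ≤⟨ ∑-mono-≤ (λ q → b2n-∨ (does (y ≟ q) ∧ does (x ≟ p)) (does (x ≟ q) ∧ does (y ≟ p))) ⟩
      ∑[ q < n ] (b2n (does (y ≟ q) ∧ does (x ≟ p)) + b2n (does (x ≟ q) ∧ does (y ≟ p)))
        ≡⟨ ∑-distrib-+ (λ q → b2n (does (y ≟ q) ∧ does (x ≟ p))) (λ q → b2n (does (x ≟ q) ∧ does (y ≟ p))) ⟩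
      _ ≡⟨ cong₂ _+_ (∑-δ y (does (x ≟ p))) (∑-δ x (does (y ≟ p))) ⟩
      b2n (does (x ≟ p)) + b2n (does (y ≟ p))
        ≤⟨ at-most-one ⟩
      1 ∎
      where
      open ≤-Reasoning
      at-most-one : b2n (does (x ≟ p)) + b2n (does (y ≟ p)) ≤ 1
      at-most-one with x ≟ p | y ≟ p
      ... | yes refl | yes refl = contradiction refl x≢y
      ... | yes _    | no _     = ≤-refl
      ... | no _     | yes _    = ≤-refl
      ... | no _     | no _     = z≤n

  link-xy : link x y x y ≡ true
  link-xy rewrite dec-true (y ≟ y) refl | dec-true (x ≟ x) refl = refl

∪-⊆ : ∀ {n} {a b c : Adj n} → a ⊆ₐ c → b ⊆ₐ c → (a ∪ b) ⊆ₐ c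
∪-⊆ {a = a} a⊆c b⊆c i j a∪bij with a i j in aij
... | true  = a⊆c i j aij
... | false = b⊆c i j a∪bij

⊆-∪ : ∀ {n} (a b : Adj n) → a ⊆ₐ (a ∪ b)
⊆-∪ a b i j aij rewrite aij = refl

<ᵇ-true : ∀ {m n} → m < n → (m <ᵇ n) ≡ true
<ᵇ-true m<n = Equivalence.to Bool.T-≡ (<⇒<ᵇ m<n)

edgeCount-mono-< : ∀ {n} {a b : Adj n} {x y} → a ⊆ₐ b → toℕ x < toℕ y → a x y ≡ false → b x y ≡ true →
                   edgeCount a < edgeCount b
edgeCount-mono-< {a = a} {b} {x} {y} a⊆b x<y axy bxy =
  ∑-mono-< (λ i → ∑-mono-≤ (entry-mono i)) x (∑-mono-< (entry-mono x) y xy-strict)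
  where
  entry-mono : ∀ i j → (if toℕ i <ᵇ toℕ j then b2n (a i j) else 0) ≤ (if toℕ i <ᵇ toℕ j then b2n (b i j) else 0)
  entry-mono i j = if-mono (toℕ i <ᵇ toℕ j) (b2n-mono (a⊆b i j))
  xy-strict : (if toℕ x <ᵇ toℕ y then b2n (a x y) else 0) < (if toℕ x <ᵇ toℕ y then b2n (b x y) else 0)
  xy-strict rewrite <ᵇ-true x<y | axy | bxy = ≤-refl

module _ {G : Graph} (s : Spanning G) {x y : Fin (n G)} (xy∈G : adj G x y ≡ true) where

  private
    x≢y : x ≢ y
    x≢y refl = contradiction (trans (sym xy∈G) (irrefl G x)) λ ()

  insertEdge : Spanning G
  insertEdge = record
    { edge        = edge s ∪ link x y
    ; edge-sym    = λ p q → cong₂ _∨_ (edge-sym s p q) (link-sym {x = x} {y} p q)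
    ; edge-irrefl = λ p → cong₂ _∨_ (edge-irrefl s p) (link-irrefl x≢y p)
    ; edge-⊆      = ∪-⊆ (edge-⊆ s) link⊆G
    }
    where
    link⊆G : link x y ⊆ₐ adj G
    link⊆G p q xy≡pq with link-endpoints {x = x} {y} xy≡pq
    ... | inj₁ (refl , refl) = xy∈G
    ... | inj₂ (refl , refl) = trans (Graph.sym G y x) xy∈G

  maxDegree-insertEdge : maxDegree (edge insertEdge) ≤ suc (maxDegree (edge s))
  maxDegree-insertEdge = ⨆-lub λ p → begin
    degree (edge s ∪ link x y) p          ≤⟨ degree-∪ (edge s) (link x y) p ⟩
    degree (edge s) p + degree (link x y) p ≤⟨ +-mono-≤ (≤-⨆ (degree (edge s)) p) (degree-link x≢y p) ⟩
    maxDegree (edge s) + 1                 ≡⟨ +-comm _ 1 ⟩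
    suc (maxDegree (edge s))               ∎
    where open ≤-Reasoning

  edgeCount-insertEdge : toℕ x < toℕ y → edge s x y ≡ false → edgeCount (edge s) < edgeCount (edge insertEdge)
  edgeCount-insertEdge x<y xy∉s = edgeCount-mono-< (⊆-∪ (edge s) (link x y)) x<y xy∉s
    (trans (cong (edge s x y ∨_) (link-xy {x = x} {y})) (Bool.∨-zeroʳ _))

b2n-< : ∀ {p q} → b2n p < b2n q → p ≡ false × q ≡ true
b2n-< {false} {true}  _ = refl , refl
b2n-< {true}  {true}  (s≤s ())
b2n-< {false} {false} ()

missingEdge : ∀ {G} (s : Spanning G) v → degree (edge s) v < degree (adj G) v →
              ∃₂ λ x y → toℕ x < toℕ y × adj G x y ≡ true × edge s x y ≡ false
missingEdge {G} s v deg< with ∑-<⇒∃< deg<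
... | w , vw< with b2n-< vw< | <-cmp (toℕ v) (toℕ w)
...   | vw∉s , vw∈G | tri< v<w _ _ = v , w , v<w , vw∈G , vw∉s
...   | vw∉s , vw∈G | tri> _ _ w<v = w , v , w<v , trans (Graph.sym G w v) vw∈G , trans (edge-sym s w v) vw∉s
...   | _    , vw∈G | tri≈ _ v≡w _ with Fin.toℕ-injective v≡w
...     | refl = contradiction (trans (sym vw∈G) (irrefl G v)) λ ()

-- If a largest subgraph of maximum degree at most Δ(G) − 1 stayed below Δ(G) − 1, a vertex of
-- maximum degree in G would still miss one of its edges, and that edge could be added.
largest-lowered : ∀ {G} (L : LargestWithin G (maxDeg G ∸ 1)) →
                  maxDegree (edge (LargestWithin.spanning L)) ≡ maxDeg G ∸ 1
largest-lowered {G} L = ≤-antisym within (≮⇒≥ not-below)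
  where
  open LargestWithin L renaming (spanning to s)
  not-below : ¬ maxDegree (edge s) < maxDeg G ∸ 1
  not-below below with <-⨆⇒∃< (<-≤-trans below (≤-trans (m∸n≤m _ 1) (≤-reflexive (maxDeg≡maxDegree G))))
  ... | v , Δs<degv with missingEdge s v (≤-<-trans (≤-⨆ (degree (edge s)) v) Δs<degv)
  ...   | x , y , x<y , xy∈G , xy∉s = <⇒≱ (edgeCount-insertEdge s xy∈G x<y xy∉s)
          (largest (insertEdge s xy∈G) (≤-trans (maxDegree-insertEdge s xy∈G) below))

NeedsDeletions : Graph → ℕ → ℕ → Set
NeedsDeletions G d k = ∀ (s : Spanning G) → maxDegree (edge s) ≤ d → k + edgeCount (edge s) ≤ edgeCount (adj G)

es-exists : ∀ G → ∃ (ES G)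
es-exists G =
  deleted (asDeletion spanning) , (asDeletion spanning , asDeletion-lowers spanning lowered , refl) , minimal
  where
  L : LargestWithin G (maxDeg G ∸ 1)
  L = largestWithin G (maxDeg G ∸ 1)
  open LargestWithin L
  lowered : maxDegree (edge spanning) ≡ maxDeg G ∸ 1
  lowered = largest-lowered L
  minimal : ∀ D → Lowers G D → deleted (asDeletion spanning) ≤ deleted D
  minimal D D-lowers = begin
    deleted (asDeletion spanning)                          ≡⟨ deleted-fromDeletion (asDeletion spanning) ⟩
    edgeCount (adj G) ∸ edgeCount (edge spanning)          ≤⟨ ∸-monoʳ-≤ _ (largest (fromDeletion D) D-within) ⟩
    edgeCount (adj G) ∸ edgeCount (edge (fromDeletion D))  ≡⟨ deleted-fromDeletion D ⟨
    deleted D                                              ∎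
    where
    open ≤-Reasoning
    D-within : maxDegree (edge (fromDeletion D)) ≤ maxDeg G ∸ 1
    D-within = ≤-reflexive (fromDeletion-lowers D D-lowers)

es⇒NeedsDeletions : ∀ {G k} → ES G k → NeedsDeletions G (maxDeg G ∸ 1) k
es⇒NeedsDeletions {G} {k} (_ , minimal) s s≤ = begin
  k + edgeCount (edge s)
    ≤⟨ +-mono-≤ (minimal (asDeletion spanning) (asDeletion-lowers spanning (largest-lowered L))) (largest s s≤) ⟩
  deleted (asDeletion spanning) + edgeCount (edge spanning)
    ≡⟨ cong (_+ edgeCount (edge spanning)) (deleted-fromDeletion (asDeletion spanning)) ⟩
  edgeCount (adj G) ∸ edgeCount (edge spanning) + edgeCount (edge spanning)
    ≡⟨ m∸n+n≡m (edgeCount-mono (edge-⊆ spanning)) ⟩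
  edgeCount (adj G) ∎
  where
  open ≤-Reasoning
  L : LargestWithin G (maxDeg G ∸ 1)
  L = largestWithin G (maxDeg G ∸ 1)
  open LargestWithin L

NeedsDeletions⇒≤es : ∀ {G k k′} → NeedsDeletions G (maxDeg G ∸ 1) k → ES G k′ → k ≤ k′
NeedsDeletions⇒≤es {G} {k} needs ((D , D-lowers , refl) , _) =
  subst (k ≤_) (sym (deleted-fromDeletion D))
    (m+n≤o⇒m≤o∸n k (needs (fromDeletion D) (≤-reflexive (fromDeletion-lowers D D-lowers))))

-- Two copies of a graph

<ᵇ-↑ˡ↑ʳ : ∀ {m} (i : Fin m) n (j : Fin n) → (toℕ (i ↑ˡ n) <ᵇ toℕ (m ↑ʳ j)) ≡ true
<ᵇ-↑ˡ↑ʳ zero    n j = refl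
<ᵇ-↑ˡ↑ʳ (suc i) n j = <ᵇ-↑ˡ↑ʳ i n j

<ᵇ-↑ʳ↑ˡ : ∀ {m} (j : Fin m) n (i : Fin n) → (toℕ (m ↑ʳ i) <ᵇ toℕ (j ↑ˡ n)) ≡ false
<ᵇ-↑ʳ↑ˡ zero    n i = refl
<ᵇ-↑ʳ↑ˡ (suc j) n i = <ᵇ-↑ʳ↑ˡ j n i

<ᵇ-↑ʳ↑ʳ : ∀ m {n} (i j : Fin n) → (toℕ (m ↑ʳ i) <ᵇ toℕ (m ↑ʳ j)) ≡ (toℕ i <ᵇ toℕ j)
<ᵇ-↑ʳ↑ʳ zero    i j = refl
<ᵇ-↑ʳ↑ʳ (suc m) i j = <ᵇ-↑ʳ↑ʳ m i j

module _ (m n : ℕ) (b : Adj (m + n)) where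

  topLeft : Adj m
  topLeft i j = b (i ↑ˡ n) (j ↑ˡ n)

  bottomRight : Adj n
  bottomRight i j = b (m ↑ʳ i) (m ↑ʳ j)

  crossCount : ℕ
  crossCount = ∑[ i < m ] ∑[ j < n ] b2n (b (i ↑ˡ n) (m ↑ʳ j))

  edgeCount-blocks : edgeCount b ≡ edgeCount topLeft + crossCount + edgeCount bottomRight
  edgeCount-blocks = begin
    edgeCount b
      ≡⟨ ∑-++ m {n} row ⟩
    ∑[ i < m ] row (i ↑ˡ n) + ∑[ i < n ] row (m ↑ʳ i)
      ≡⟨ cong₂ _+_ (sum-cong-≗ upper) (sum-cong-≗ lower) ⟩
    ∑[ i < m ] (upperLeft i + upperRight i) + edgeCount bottomRight
      ≡⟨ cong (_+ edgeCount bottomRight) (∑-distrib-+ upperLeft upperRight) ⟩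
    edgeCount topLeft + crossCount + edgeCount bottomRight ∎
    where
    open ≡-Reasoning
    entry : Fin (m + n) → Fin (m + n) → ℕ
    entry x y = if toℕ x <ᵇ toℕ y then b2n (b x y) else 0
    row : Fin (m + n) → ℕ
    row x = sum (entry x)
    upperLeft upperRight : Fin m → ℕ
    upperLeft i = ∑[ j < m ] (if toℕ i <ᵇ toℕ j then b2n (topLeft i j) else 0)
    upperRight i = ∑[ j < n ] b2n (b (i ↑ˡ n) (m ↑ʳ j))
    if-cong : ∀ {c c′} x → c ≡ c′ → (if c then x else 0) ≡ (if c′ then x else 0)
    if-cong x = cong (λ c → if c then x else 0)
    upper : ∀ i → row (i ↑ˡ n) ≡ upperLeft i + upperRight i
    upper i = trans (∑-++ m {n} (entry (i ↑ˡ n))) (cong₂ _+_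
      (sum-cong-≗ λ j → if-cong (b2n (topLeft i j)) (cong₂ _<ᵇ_ (Fin.toℕ-↑ˡ i n) (Fin.toℕ-↑ˡ j n)))
      (sum-cong-≗ λ j → if-cong (b2n (b (i ↑ˡ n) (m ↑ʳ j))) (<ᵇ-↑ˡ↑ʳ i n j)))
    lower : ∀ i → row (m ↑ʳ i) ≡ ∑[ j < n ] (if toℕ i <ᵇ toℕ j then b2n (bottomRight i j) else 0)
    lower i = trans (∑-++ m {n} (entry (m ↑ʳ i))) (cong₂ _+_
      (trans (sum-cong-≗ λ j → if-cong (b2n (b (m ↑ʳ i) (j ↑ˡ n))) (<ᵇ-↑ʳ↑ˡ j n i)) (sum-replicate-zero m))
      (sum-cong-≗ λ j → if-cong (b2n (bottomRight i j)) (<ᵇ-↑ʳ↑ʳ m i j)))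

  degree-topLeft : ∀ i → degree topLeft i ≤ degree b (i ↑ˡ n)
  degree-topLeft i = ≤-trans (m≤m+n _ _) (≤-reflexive (sym (∑-++ m {n} (λ y → b2n (b (i ↑ˡ n) y)))))

  degree-bottomRight : ∀ i → degree bottomRight i ≤ degree b (m ↑ʳ i)
  degree-bottomRight i = ≤-trans (m≤n+m _ _) (≤-reflexive (sym (∑-++ m {n} (λ y → b2n (b (m ↑ʳ i) y)))))

crossCount-mono : ∀ m n {a b : Adj (m + n)} → a ⊆ₐ b → crossCount m n a ≤ crossCount m n b
crossCount-mono m n a⊆b = ∑-mono-≤ λ i → ∑-mono-≤ λ j → b2n-mono (a⊆b (i ↑ˡ n) (m ↑ʳ j))

module TwoCopies (K : Graph) (joined : Fin (n K) → Bool) where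

  private
    N = n K

  twin : Fin N → Fin N → Bool
  twin i j = does (i ≟ j) ∧ joined i

  twin-sym : ∀ i j → twin i j ≡ twin j i
  twin-sym i j with i ≟ j | j ≟ i
  ... | yes refl | yes _    = refl
  ... | no _     | no _     = refl
  ... | yes refl | no i≢i   = contradiction refl i≢i
  ... | no i≢i   | yes refl = contradiction refl i≢i

  adj⊎ : Fin N ⊎ Fin N → Fin N ⊎ Fin N → Bool
  adj⊎ (inj₁ i) (inj₁ j) = adj K i j
  adj⊎ (inj₂ i) (inj₂ j) = adj K i j
  adj⊎ (inj₁ i) (inj₂ j) = twin i j
  adj⊎ (inj₂ i) (inj₁ j) = twin i j

  adj⊎-sym : ∀ u w → adj⊎ u w ≡ adj⊎ w u
  adj⊎-sym (inj₁ i) (inj₁ j) = Graph.sym K i j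
  adj⊎-sym (inj₂ i) (inj₂ j) = Graph.sym K i j
  adj⊎-sym (inj₁ i) (inj₂ j) = twin-sym i j
  adj⊎-sym (inj₂ i) (inj₁ j) = twin-sym i j

  adj⊎-irrefl : ∀ u → adj⊎ u u ≡ false
  adj⊎-irrefl (inj₁ i) = irrefl K i
  adj⊎-irrefl (inj₂ i) = irrefl K i

  graph : Graph
  graph = record
    { n      = N + N
    ; adj    = λ x y → adj⊎ (splitAt N x) (splitAt N y)
    ; sym    = λ x y → adj⊎-sym (splitAt N x) (splitAt N y)
    ; irrefl = λ x → adj⊎-irrefl (splitAt N x)
    }

  adj-↑ˡ↑ˡ : ∀ i j → adj graph (i ↑ˡ N) (j ↑ˡ N) ≡ adj K i j
  adj-↑ˡ↑ˡ i j rewrite Fin.splitAt-↑ˡ N i N | Fin.splitAt-↑ˡ N j N = refl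

  adj-↑ʳ↑ʳ : ∀ i j → adj graph (N ↑ʳ i) (N ↑ʳ j) ≡ adj K i j
  adj-↑ʳ↑ʳ i j rewrite Fin.splitAt-↑ʳ N N i | Fin.splitAt-↑ʳ N N j = refl

  origin : Fin (N + N) → Fin N
  origin x = [ id , id ]′ (splitAt N x)

  degree-graph : ∀ x → degree (adj graph) x ≡ degree (adj K) (origin x) + b2n (joined (origin x))
  degree-graph x = trans (∑-++ N (λ y → b2n (adj graph x y)))
    (trans (cong₂ _+_ (sum-cong-≗ λ j → cong (b2n ∘ adj⊎ (splitAt N x)) (Fin.splitAt-↑ˡ N j N))
                      (sum-cong-≗ λ j → cong (b2n ∘ adj⊎ (splitAt N x)) (Fin.splitAt-↑ʳ N N j)))
           (by-side (splitAt N x)))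
    where
    by-side : ∀ u → ∑[ j < N ] b2n (adj⊎ u (inj₁ j)) + ∑[ j < N ] b2n (adj⊎ u (inj₂ j))
                    ≡ degree (adj K) ([ id , id ]′ u) + b2n (joined ([ id , id ]′ u))
    by-side (inj₁ i) = cong (degree (adj K) i +_) (∑-δ i (joined i))
    by-side (inj₂ i) = trans (cong (_+ degree (adj K) i) (∑-δ i (joined i)))
                             (+-comm (b2n (joined i)) (degree (adj K) i))

  hasEdge-graph : HasEdge K → HasEdge graph
  hasEdge-graph (i , j , ij∈K) = i ↑ˡ N , j ↑ˡ N , trans (adj-↑ˡ↑ˡ i j) ij∈K

  restrict : (copy : Fin N → Fin (N + N)) → (∀ i j → adj graph (copy i) (copy j) ≡ adj K i j) →
             Spanning graph → Spanning K
  restrict copy adj-copy s = record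
    { edge        = λ i j → edge s (copy i) (copy j)
    ; edge-sym    = λ i j → edge-sym s (copy i) (copy j)
    ; edge-irrefl = λ i → edge-irrefl s (copy i)
    ; edge-⊆      = λ i j sij → trans (sym (adj-copy i j)) (edge-⊆ s (copy i) (copy j) sij)
    }

  edgeCount-graph : edgeCount (adj graph) ≡ edgeCount (adj K) + crossCount N N (adj graph) + edgeCount (adj K)
  edgeCount-graph = trans (edgeCount-blocks N N (adj graph))
    (cong₂ (λ e₁ e₂ → e₁ + crossCount N N (adj graph) + e₂) (edgeCount-cong adj-↑ˡ↑ˡ) (edgeCount-cong adj-↑ʳ↑ʳ))

  needsDeletions : ∀ {d k} → NeedsDeletions K d k → NeedsDeletions graph d (k + k)
  needsDeletions {d} {k} needs s s≤d = begin
    (k + k) + edgeCount (edge s)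
      ≡⟨ cong ((k + k) +_) (edgeCount-blocks N N (edge s)) ⟩
    (k + k) + (edgeCount (edge s₁) + crossCount N N (edge s) + edgeCount (edge s₂))
      ≡⟨ solve 4 (λ k e₁ c e₂ → (k :+ k) :+ (e₁ :+ c :+ e₂) := (k :+ e₁) :+ c :+ (k :+ e₂)) refl k _ _ _ ⟩
    (k + edgeCount (edge s₁)) + crossCount N N (edge s) + (k + edgeCount (edge s₂))
      ≤⟨ +-mono-≤ (+-mono-≤ (needs s₁ s₁≤d) (crossCount-mono N N (edge-⊆ s))) (needs s₂ s₂≤d) ⟩
    edgeCount (adj K) + crossCount N N (adj graph) + edgeCount (adj K)
      ≡⟨ edgeCount-graph ⟨
    edgeCount (adj graph) ∎
    where
    open ≤-Reasoning
    open +-*-Solver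
    s₁ s₂ : Spanning K
    s₁ = restrict (_↑ˡ N) adj-↑ˡ↑ˡ s
    s₂ = restrict (N ↑ʳ_) adj-↑ʳ↑ʳ s
    s₁≤d : maxDegree (edge s₁) ≤ d
    s₁≤d = ≤-trans (⨆-lub λ i → ≤-trans (degree-topLeft N N (edge s) i) (≤-⨆ (degree (edge s)) (i ↑ˡ N))) s≤d
    s₂≤d : maxDegree (edge s₂) ≤ d
    s₂≤d = ≤-trans (⨆-lub λ i → ≤-trans (degree-bottomRight N N (edge s) i) (≤-⨆ (degree (edge s)) (N ↑ʳ i))) s≤d

-- Iterated doubling

double : ℕ → Graph → Graph
double Δ K = TwoCopies.graph K (λ i → degree (adj K) i <ᵇ Δ)

doubleⁿ : ℕ → ℕ → Graph → Graph
doubleⁿ Δ zero    G = G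
doubleⁿ Δ (suc t) G = double Δ (doubleⁿ Δ t G)

2^[1+t]*m : ∀ t m → 2 ^ t * m + 2 ^ t * m ≡ 2 ^ suc t * m
2^[1+t]*m t m = sym (trans (*-assoc 2 (2 ^ t) m) (cong (2 ^ t * m +_) (+-identityʳ _)))

raise-deficient : ∀ Δ t d → t ⊓ Δ ≤ d → d ≤ Δ →
                  suc t ⊓ Δ ≤ d + b2n (d <ᵇ Δ) × d + b2n (d <ᵇ Δ) ≤ Δ
raise-deficient Δ t d t⊓Δ≤d d≤Δ with d <ᵇ Δ | <ᵇ-reflects-< d Δ
... | true  | ofʸ d<Δ = ≤-trans (⊓-monoʳ-≤ (suc t) (n≤1+n Δ)) (≤-trans (s≤s t⊓Δ≤d) (≤-reflexive (+-comm 1 d))) ,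
                ≤-trans (≤-reflexive (+-comm d 1)) d<Δ
... | false | ofⁿ d≮Δ = ≤-trans (m⊓n≤n (suc t) Δ) (≤-trans (≮⇒≥ d≮Δ) (≤-reflexive (sym (+-identityʳ d)))) ,
                ≤-trans (≤-reflexive (+-identityʳ d)) d≤Δ

module _ (Δ : ℕ) (G : Graph) where

  n-doubleⁿ : ∀ t → n (doubleⁿ Δ t G) ≡ 2 ^ t * n G
  n-doubleⁿ zero    = sym (+-identityʳ (n G))
  n-doubleⁿ (suc t) = trans (cong₂ _+_ (n-doubleⁿ t) (n-doubleⁿ t)) (2^[1+t]*m t (n G))

  hasEdge-doubleⁿ : HasEdge G → ∀ t → HasEdge (doubleⁿ Δ t G)
  hasEdge-doubleⁿ G∋e zero    = G∋e
  hasEdge-doubleⁿ G∋e (suc t) = TwoCopies.hasEdge-graph _ _ (hasEdge-doubleⁿ G∋e t)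

  needsDeletions-doubleⁿ : ∀ {d k} → NeedsDeletions G d k → ∀ t → NeedsDeletions (doubleⁿ Δ t G) d (2 ^ t * k)
  needsDeletions-doubleⁿ {d} {k} needs zero = subst (NeedsDeletions G d) (sym (+-identityʳ k)) needs
  needsDeletions-doubleⁿ {d} {k} needs (suc t) =
    subst (NeedsDeletions (doubleⁿ Δ (suc t) G) d) (2^[1+t]*m t k)
      (TwoCopies.needsDeletions _ _ (needsDeletions-doubleⁿ needs t))

  degree-doubleⁿ : maxDeg G ≤ Δ → ∀ t v →
                   t ⊓ Δ ≤ degree (adj (doubleⁿ Δ t G)) v × degree (adj (doubleⁿ Δ t G)) v ≤ Δ
  degree-doubleⁿ G≤Δ zero    v = z≤n , ≤-trans (≤-⨆ (degree (adj G)) v) (subst (_≤ Δ) (maxDeg≡maxDegree G) G≤Δ)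
  degree-doubleⁿ G≤Δ (suc t) v
    rewrite TwoCopies.degree-graph (doubleⁿ Δ t G) (λ i → degree (adj (doubleⁿ Δ t G)) i <ᵇ Δ) v =
    uncurry (raise-deficient Δ t _) (degree-doubleⁿ G≤Δ t _)

  regular-doubleⁿ : maxDeg G ≤ Δ → Regular Δ (doubleⁿ Δ Δ G)
  regular-doubleⁿ G≤Δ v with degree-doubleⁿ G≤Δ Δ v
  ... | Δ⊓Δ≤d , d≤Δ = trans (deg≡degree (doubleⁿ Δ Δ G) v)
    (≤-antisym d≤Δ (subst (_≤ degree (adj (doubleⁿ Δ Δ G)) v) (⊓-idem Δ) Δ⊓Δ≤d))

regular⇒maxDeg : ∀ {Δ} H → Regular Δ H → HasEdge H → maxDeg H ≡ Δ
regular⇒maxDeg {Δ} H regular (i , _) = trans (maxDeg≡maxDegree H)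
  (≤-antisym (⨆-lub λ v → ≤-reflexive (degH v)) (≤-trans (≤-reflexive (sym (degH i))) (≤-⨆ _ i)))
  where
  degH : ∀ v → degree (adj H) v ≡ Δ
  degH v = trans (sym (deg≡degree H v)) (regular v)

es-doubleⁿ : ∀ Δ t {G k k′} → ES G k → maxDeg (doubleⁿ Δ t G) ≡ maxDeg G → ES (doubleⁿ Δ t G) k′ →
             2 ^ t * k ≤ k′
es-doubleⁿ Δ t {G} {k} esG same-maxDeg = NeedsDeletions⇒≤es
  (subst (λ D → NeedsDeletions (doubleⁿ Δ t G) (D ∸ 1) (2 ^ t * k)) (sym same-maxDeg)
    (needsDeletions-doubleⁿ Δ G (es⇒NeedsDeletions esG) t))

-- On the literal mkℚ (+ a) 0 _, multiplication and order of ℚ compute.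
ℕtoℚ≡mkℚ : ∀ a → ℕtoℚ a ≡ mkℚ (ℤ.+ a) 0 (coprime-sym (1-coprimeTo a))
ℕtoℚ≡mkℚ a = ℚ.↥p/↧p≡p (mkℚ (ℤ.+ a) 0 (coprime-sym (1-coprimeTo a)))

ℕtoℚ-* : ∀ a b → ℕtoℚ (a * b) ≡ ℕtoℚ a ℚ.* ℕtoℚ b
ℕtoℚ-* a b = trans (cong (ℚ._/ 1) (sym (ℤ.+◃n≡+n (a * b)))) (sym (cong₂ ℚ._*_ (ℕtoℚ≡mkℚ a) (ℕtoℚ≡mkℚ b)))

ℕtoℚ-mono : ∀ {a b} → a ≤ b → ℕtoℚ a ℚ.≤ ℕtoℚ b
ℕtoℚ-mono {a} {b} a≤b rewrite ℕtoℚ≡mkℚ a | ℕtoℚ≡mkℚ b = ℚ.*≤* (ℤ.*-monoʳ-≤-nonNeg (ℤ.+ 1) (ℤ.+≤+ a≤b))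

ℕtoℚ-pos : ∀ a → ℚ.Positive (ℕtoℚ (suc a))
ℕtoℚ-pos a rewrite ℕtoℚ≡mkℚ (suc a) = _

ℕtoℚ-cancel : ∀ m {k K N} c → 0 < m → m * k ≤ K → ℕtoℚ K ℚ.≤ c ℚ.* ℕtoℚ (m * N) → ℕtoℚ k ℚ.≤ c ℚ.* ℕtoℚ N
ℕtoℚ-cancel (suc m) {k} {K} {N} c _ mk≤K K≤cmN = ℚ.*-cancelˡ-≤-pos M {{ℕtoℚ-pos m}} (begin
  M ℚ.* ℕtoℚ k              ≡⟨ ℕtoℚ-* (suc m) k ⟨
  ℕtoℚ (suc m * k)          ≤⟨ ℕtoℚ-mono mk≤K ⟩
  ℕtoℚ K                    ≤⟨ K≤cmN ⟩
  c ℚ.* ℕtoℚ (suc m * N)    ≡⟨ cong (c ℚ.*_) (ℕtoℚ-* (suc m) N) ⟩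
  c ℚ.* (M ℚ.* ℕtoℚ N)      ≡⟨ sym (ℚ.*-assoc c M _) ⟩
  (c ℚ.* M) ℚ.* ℕtoℚ N      ≡⟨ cong (ℚ._* ℕtoℚ N) (ℚ.*-comm c M) ⟩
  (M ℚ.* c) ℚ.* ℕtoℚ N      ≡⟨ ℚ.*-assoc M c _ ⟩
  M ℚ.* (c ℚ.* ℕtoℚ N)      ∎)
  where
  open ℚ.≤-Reasoning
  M = ℕtoℚ (suc m)

theorem3p2 : (Δ : ℕ) → 0 < Δ → (c : ℚ) → 0ℚ <ℚ c → c <ℚ 1ℚ →
    (∀ (H : Graph) → HasEdge H → Regular Δ H → maxDeg H ≡ Δ →
       ∀ k → ES H k → ℕtoℚ k ℚ.≤ c ℚ.* ℕtoℚ (n H)) →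
    ∀ (G : Graph) → HasEdge G → maxDeg G ≡ Δ →
       ∀ k → ES G k → ℕtoℚ k ℚ.≤ c ℚ.* ℕtoℚ (n G)
theorem3p2 Δ _ c _ _ hyp G G∋e maxDeg≡Δ k esG =
  ℕtoℚ-cancel (2 ^ Δ) c (m^n>0 2 Δ) (es-doubleⁿ Δ Δ esG (trans maxDegR (sym maxDeg≡Δ)) esR)
    (subst (λ m → ℕtoℚ kR ℚ.≤ c ℚ.* ℕtoℚ m) (n-doubleⁿ Δ G Δ) (hyp R R∋e regularR maxDegR kR esR))
  where
  R : Graph
  R = doubleⁿ Δ Δ G
  R∋e : HasEdge R
  R∋e = hasEdge-doubleⁿ Δ G G∋e Δ
  regularR : Regular Δ R
  regularR = regular-doubleⁿ Δ G (≤-reflexive maxDeg≡Δ)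
  maxDegR : maxDeg R ≡ Δ
  maxDegR = regular⇒maxDeg R regularR R∋e
  kR : ℕ
  kR = proj₁ (es-exists R)
  esR : ES R kR
  esR = proj₂ (es-exists R)
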